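{- For any two distinct vertex sets $X$ and $Y$ of the same size $k$ in a connected graph $H$ and any marginal set $A\subseteq V(H)$, there is a balanced $X$--$Y$ movement of length at most $k$ on $H$ such that $A$ is strongly singular with respect to it.
   Context: A set $A$ of vertices of $H$ is marginal if $H-A$ is connected and every vertex of $A$ has a neighbour in $H-A$. A movement on $H$ is a pair $(\mathcal{X},\mathcal{M})$ with $\mathcal{X}=(X_0,\ldots,X_n)$ subsets of $V(H)$ and $\mathcal{M}=(M_1,\ldots,M_n)$, $n\ge1$, non-trivial paths in $H$ such that for each $i$: $X_{i-1}\triangle X_i$ consists exactly of the two end vertices of $M_i$, and $M_i$ is disjoint from $X_{i-1}\cap X_i$. Its length is $n$; it is an $X$--$Y$ movement if $X_0=X$ and $X_n=Y$. For $i=1,\dots,n$ let $R_i$ be the graph on $(X_{i-1}\times\{i-1\})\cup(X_i\times\{i\})$ with edges $(x,i-1)(x,i)$ for $x\in X_{i-1}\cap X_i$ and one edge $(x,j)(y,k)$ where $x,y$ are the ends of $M_i$ and $j,k$ the unique indices with $(x,j),(y,k)\in V(R_i)$; let $\mathcal{R}$ be the multigraph on $\bigcup_i X_i\times\{i\}$ whose edge multiplicities count the $R_i$ containing the edge. Its components meeting $(X_0\times\{0\})\cup(X_n\times\{n\})$ are paths with both ends in that set; the induced pairing is the graph on $(X_0\times\{0\})\cup(X_n\times\{\infty\})$ (renaming $(x,n)$ as $(x,\infty)$) where two vertices are adjacent iff they are the ends of one such path. For sets $X,Y$, an $(X,Y)$-pairing is any 1-regular graph on $(X\times\{0\})\cup(Y\times\{\infty\})$;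 it is balanced if every edge has one end in $X\times\{0\}$ and one in $Y\times\{\infty\}$. A movement is balanced if its induced pairing is. A vertex $x$ is $(\mathcal{X},\mathcal{M})$-singular if no move contains $x$ as an inner vertex and $I_x=\{i: x\in X_i\}$ is a (possibly empty) set of consecutive integers; it is strongly singular if moreover $I_x$ is empty or contains $0$ or $n$. A set is (strongly) singular if all its vertices are. -}

module Defs where

open import Level using (0ℓ)
open import Data.Nat using (ℕ; zero; suc; _≤_; _<_)
open import Data.Fin using (Fin)
open import Data.Fin.Subset using (Subset; _∈_; _∉_; ∣_∣)
open import Data.List using (List; [])
open import Data.List.NonEmpty using (List⁺; _∷_; toList; last)
open import Data.List.Relation.Unary.Linked using (Linked)
open import Data.List.Relation.Unary.Unique.Propositional using (Unique)
open import Data.List.Membership.Propositional using () renaming (_∈_ to _∈ₗ_)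
open import Data.Product using (_×_; Σ; ∃; _,_)
open import Data.Sum using (_⊎_)
open import Relation.Nullary using (¬_)
open import Relation.Binary.PropositionalEquality using (_≡_; _≢_)
open import Relation.Binary.Construct.Closure.ReflexiveTransitive using (Star)
open import Relation.Binary.Construct.Closure.Symmetric using (SymClosure)

record Graph : Set₁ where
  field
    N     : ℕ
    Adj   : Fin N → Fin N → Set
    sym   : ∀ {u v} → Adj u v → Adj v u
    irrefl : ∀ {u} → ¬ Adj u u
open Graph public

Connected : Graph → Set
Connected H = ∀ (u v : Fin (N H)) → Star (Adj H) u v

AdjMinus : (H : Graph) → Subset (N H) → Fin (N H) → Fin (N H) → Set
AdjMinus H A u v = u ∉ A × v ∉ A × Adj H u v

Marginal : (H : Graph) → Subset (N H) → Set
Marginal H A =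
  (∀ (u v : Fin (N H)) → u ∉ A → v ∉ A → Star (AdjMinus H A) u v)
  × (∀ (a : Fin (N H)) → a ∈ A → ∃ λ v → v ∉ A × Adj H a v)

record Path (H : Graph) : Set where
  constructor mkPath
  field
    start : Fin (N H)
    rest  : List (Fin (N H))
  verts : List⁺ (Fin (N H))
  verts = start ∷ rest
  end : Fin (N H)
  end = last verts
open Path public

IsNontrivialPath : (H : Graph) → Path H → Set
IsNontrivialPath H P =
  rest P ≢ [] × Linked (Adj H) (toList (verts P)) × Unique (toList (verts P))

OnPath : {H : Graph} → Fin (N H) → Path H → Set
OnPath x P = x ∈ₗ toList (verts P)

Inner : {H : Graph} → Fin (N H) → Path H → Set
Inner x P = OnPath x P × x ≢ start P × x ≢ end P

-- Movements.  The sets X_0,…,X_len are  sets 0, …, sets len,  and the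
-- paths M_1,…,M_len are  moves 1, …, moves len  (values outside these
-- index ranges are irrelevant).

record Movement (H : Graph) : Set where
  field
    len   : ℕ
    sets  : ℕ → Subset (N H)
    moves : ℕ → Path H
open Movement public

IsMovement : (H : Graph) → Movement H → Set
IsMovement H mv =
  1 ≤ len mv ×
  (∀ m → m < len mv →
     IsNontrivialPath H (moves mv (suc m))
     × (∀ x → ((x ∈ sets mv m × x ∉ sets mv (suc m))
               ⊎ (x ∉ sets mv m × x ∈ sets mv (suc m)))
              ⇔′ (x ≡ start (moves mv (suc m)) ⊎ x ≡ end (moves mv (suc m))))
     × (∀ x → OnPath x (moves mv (suc m)) →
              ¬ (x ∈ sets mv m × x ∈ sets mv (suc m))))
  where
  _⇔′_ : Set → Set → Set
  P ⇔′ Q = (P → Q) × (Q → P)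

-- The multigraph R.  Its vertices are pairs (time j , vertex x);
-- since only connectivity matters, multiplicities are ignored.

RVertex : Graph → Set
RVertex H = ℕ × Fin (N H)

-- j is the unique index in {i-1, i} (i = suc m) with (v, j) ∈ V(R_i)
StepIndex : {H : Graph} → Movement H → ℕ → Fin (N H) → ℕ → Set
StepIndex mv m v j = (j ≡ m × v ∈ sets mv m) ⊎ (j ≡ suc m × v ∉ sets mv m)

data REdge {H : Graph} (mv : Movement H) (m : ℕ) : RVertex H → RVertex H → Set where
  vertical : ∀ {x} → x ∈ sets mv m → x ∈ sets mv (suc m) →
             REdge mv m (m , x) (suc m , x)
  moveEdge : ∀ {j k} →
             StepIndex mv m (start (moves mv (suc m))) j →
             StepIndex mv m (end (moves mv (suc m))) k →
             REdge mv m (j , start (moves mv (suc m))) (k , end (moves mv (suc m)))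

REdgeAll : {H : Graph} → Movement H → RVertex H → RVertex H → Set
REdgeAll mv u v = Σ ℕ λ m → m < len mv × REdge mv m u v

RConnected : {H : Graph} → Movement H → RVertex H → RVertex H → Set
RConnected mv = Star (SymClosure (REdgeAll mv))

Side0 : {H : Graph} → Movement H → RVertex H → Set
Side0 mv (j , x) = j ≡ 0 × x ∈ sets mv 0

SideInf : {H : Graph} → Movement H → RVertex H → Set
SideInf mv (j , x) = j ≡ len mv × x ∈ sets mv (len mv)

Boundary : {H : Graph} → Movement H → RVertex H → Set
Boundary mv u = Side0 mv u ⊎ SideInf mv u

-- induced pairing: two distinct boundary vertices are paired iff they are
-- the two ends of one path component of R, i.e. lie in the same component.
Paired : {H : Graph} → Movement H → RVertex H → RVertex H → Set
Paired mv u v = Boundary mv u × Boundary mv v × u ≢ v × RConnected mv u v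

Balanced : {H : Graph} → Movement H → Set
Balanced mv = ∀ u v → Paired mv u v →
  (Side0 mv u × SideInf mv v) ⊎ (SideInf mv u × Side0 mv v)

Singular : {H : Graph} → Movement H → Fin (N H) → Set
Singular mv x =
  (∀ m → m < len mv → ¬ Inner x (moves mv (suc m)))
  × (∀ i j l → i ≤ j → j ≤ l → l ≤ len mv →
       x ∈ sets mv i → x ∈ sets mv l → x ∈ sets mv j)

StronglySingular : {H : Graph} → Movement H → Fin (N H) → Set
StronglySingular mv x =
  Singular mv x
  × ((∀ i → i ≤ len mv → x ∉ sets mv i) ⊎ x ∈ sets mv 0 ⊎ x ∈ sets mv (len mv))

StronglySingularSet : {H : Graph} → Movement H → Subset (N H) → Set
StronglySingularSet mv A = ∀ x → x ∈ A → StronglySingular mv x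

-- Grow a spanning tree of H one vertex at a time, every new vertex attached to an earlier
-- vertex outside A; so vertices of A are leaves and never inner vertices of tree paths. The
-- vertices of A ∩ X ∩ Y keep their tokens throughout and are left out of the tree, so that no
-- vertex of A both gives up and receives a token. Peel off the most recently added vertex ℓ:
-- if ℓ lies in both or neither of X and Y, recurse without it; if ℓ ∈ Y ∖ X, one move brings
-- to ℓ the token of the first vertex x of X on a tree path from ℓ, and we recurse on X − x and
-- Y − ℓ (the case ℓ ∈ X ∖ Y is the same movement reversed). Every move carries one token along
-- its path, so tracing tokens back defines a permutation of the vertices which is constant
-- along the edges of R; injectivity of permutations makes the movement balanced. A vertex of A
-- gives up or receives its token at most once, which is strong singularity.

module Submission where

open import Defs hiding (sym)
open import Data.Nat using (ℕ; zero; suc; _≤_; _<_; z≤n; s≤s; _+_; _∸_)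
open import Data.Nat.Properties
  using (≤-refl; ≤-trans; <⇒≤; m≤n⇒m<n∨m≡n; +-suc; +-comm; +-∸-assoc; m∸n≤m; n∸n≡0;
         suc-injective; +-cancelʳ-≡; n≢0⇒n>0)
open import Data.Fin using (Fin; zero)
open import Data.Fin.Properties using (_≟_)
open import Data.Fin.Permutation using (Permutation′; transpose; _∘ₚ_; _⟨$⟩ʳ_) renaming (id to idₚ)
import Data.Fin.Permutation.Components as PC
open import Data.Fin.Subset
  using (Subset; _∈_; _∉_; ∣_∣; inside; outside; _─_; _-_; _∪_; _∩_; ⁅_⁆; ⊥; Nonempty)
  renaming (_⊆_ to _⊆ₛ_)
open import Data.Fin.Subset.Properties
  using (_∈?_; ⊆-antisym; drop-∷-⊆; nonempty?; Empty-unique; ∣⊥∣≡0; x∈⁅x⁆; x∈⁅y⁆⇒x≡y; ∣⁅x⁆∣≡1;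
         x∈p∪q⁻; p⊆p∪q; q⊆p∪q; p∩q⊆p; p∩q⊆q; x∈p∩q⁺; x∈p∧x∉q⇒x∈p─q; p─q⊆p; ∣p─q∣≤∣p∣;
         x∈p∧x≢y⇒x∈p-y)
open import Data.Vec using ([]; _∷_; here; there)
open import Data.List using (List; []; _∷_; _++_; initLast; _∷ʳ′_; allFin)
open import Data.List.NonEmpty using (_∷_; last)
open import Data.List.Membership.Propositional using () renaming (_∈_ to _∈ₗ_)
open import Data.List.Membership.Propositional.Properties using (∈-allFin)
import Data.List.Membership.DecPropositional as DecMembership
open import Data.List.Relation.Binary.Subset.Propositional using () renaming (_⊆_ to _⊆ₗ_)
open import Data.List.Relation.Binary.Subset.Propositional.Properties
  using (⊆-refl; ⊆-trans; xs⊆x∷xs; ∷⁺ʳ)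
open import Data.List.Relation.Unary.Any using (here; there)
open import Data.List.Relation.Unary.Any.Properties using (¬Any[])
open import Data.List.Relation.Unary.All using (All; []; _∷_)
import Data.List.Relation.Unary.All as All
open import Data.List.Relation.Unary.All.Properties using (¬Any⇒All¬; ++⁺)
open import Data.List.Relation.Unary.AllPairs using ([]; _∷_)
open import Data.List.Relation.Unary.Linked using (Linked; [-]; _∷_)
open import Data.List.Relation.Unary.Unique.Propositional using (Unique)
open import Data.Product using (Σ; ∃; ∃₂; _×_; _,_; proj₁; proj₂)
import Data.Product as Product
open import Data.Sum using (_⊎_; inj₁; inj₂; [_,_])
import Data.Sum as Sum
open import Data.Empty using (⊥-elim)
open import Function using (_∘_; id)
open import Function.Bundles using (Injection)
open import Function.Properties.Inverse using (↔⇒↣)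
open import Relation.Nullary using (¬_; yes; no)
open import Relation.Unary using (Decidable)
open import Relation.Binary.Definitions using (DecidableEquality)
open import Relation.Binary.PropositionalEquality
  using (_≡_; _≢_; refl; sym; trans; cong; subst; module ≡-Reasoning)
open import Relation.Binary.Construct.Closure.ReflexiveTransitive using (Star; ε; _◅_; _◅◅_)
open import Relation.Binary.Construct.Closure.Symmetric using (fwd; bwd)

private variable
  n : ℕ
  x : Fin n
  p q : Subset n

x∈p─q⇒x∉q : ∀ (p q : Subset n) → x ∈ p ─ q → x ∉ q
x∈p─q⇒x∉q (inside ∷ p) (outside ∷ q) here      ()
x∈p─q⇒x∉q (_ ∷ p)      (_ ∷ q)       (there x∈) (there x∈q) = x∈p─q⇒x∉q p q x∈ x∈q

x∉p-x : ∀ (p : Subset n) x → x ∉ p - x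
x∉p-x p x x∈ = x∈p─q⇒x∉q p ⁅ x ⁆ x∈ (x∈⁅x⁆ x)

p─q∪q≡p : q ⊆ₛ p → (p ─ q) ∪ q ≡ p
p─q∪q≡p {q = q} {p = p} q⊆p = ⊆-antisym ⊆p ⊇p
  where
  ⊆p : (p ─ q) ∪ q ⊆ₛ p
  ⊆p x∈ with x∈p∪q⁻ (p ─ q) q x∈
  ... | inj₁ x∈p─q = p─q⊆p p q x∈p─q
  ... | inj₂ x∈q   = q⊆p x∈q
  ⊇p : p ⊆ₛ (p ─ q) ∪ q
  ⊇p {x} x∈p with x ∈? q
  ... | yes x∈q = q⊆p∪q (p ─ q) q x∈q
  ... | no  x∉q = p⊆p∪q q (x∈p∧x∉q⇒x∈p─q x∈p x∉q)

∣p─q∣+∣q∣≡∣p∣ : ∀ (p q : Subset n) → q ⊆ₛ p → ∣ p ─ q ∣ + ∣ q ∣ ≡ ∣ p ∣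
∣p─q∣+∣q∣≡∣p∣ []            []            _   = refl
∣p─q∣+∣q∣≡∣p∣ (inside ∷ p)  (inside ∷ q)  q⊆p =
  trans (+-suc ∣ p ─ q ∣ ∣ q ∣) (cong suc (∣p─q∣+∣q∣≡∣p∣ p q (drop-∷-⊆ q⊆p)))
∣p─q∣+∣q∣≡∣p∣ (outside ∷ p) (inside ∷ q)  q⊆p with () ← q⊆p here
∣p─q∣+∣q∣≡∣p∣ (inside ∷ p)  (outside ∷ q) q⊆p = cong suc (∣p─q∣+∣q∣≡∣p∣ p q (drop-∷-⊆ q⊆p))
∣p─q∣+∣q∣≡∣p∣ (outside ∷ p) (outside ∷ q) q⊆p = ∣p─q∣+∣q∣≡∣p∣ p q (drop-∷-⊆ q⊆p)

x∈p⇒⁅x⁆⊆p : x ∈ p → ⁅ x ⁆ ⊆ₛ p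
x∈p⇒⁅x⁆⊆p {x = x} x∈p y∈⁅x⁆ = subst (_∈ _) (sym (x∈⁅y⁆⇒x≡y x y∈⁅x⁆)) x∈p

x∈p⇒p-x∪⁅x⁆≡p : x ∈ p → (p - x) ∪ ⁅ x ⁆ ≡ p
x∈p⇒p-x∪⁅x⁆≡p x∈p = p─q∪q≡p (x∈p⇒⁅x⁆⊆p x∈p)

x∈p⇒suc∣p-x∣≡∣p∣ : x ∈ p → suc ∣ p - x ∣ ≡ ∣ p ∣
x∈p⇒suc∣p-x∣≡∣p∣ {x = x} {p = p} x∈p = begin
  suc ∣ p - x ∣          ≡⟨ +-comm 1 ∣ p - x ∣ ⟩
  ∣ p - x ∣ + 1          ≡⟨ cong (∣ p - x ∣ +_) (∣⁅x⁆∣≡1 x) ⟨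
  ∣ p - x ∣ + ∣ ⁅ x ⁆ ∣  ≡⟨ ∣p─q∣+∣q∣≡∣p∣ p ⁅ x ⁆ (x∈p⇒⁅x⁆⊆p x∈p) ⟩
  ∣ p ∣                  ∎
  where open ≡-Reasoning

∣p∣≡suc⇒Nonempty : ∀ {k} (p : Subset n) → ∣ p ∣ ≡ suc k → Nonempty p
∣p∣≡suc⇒Nonempty {n} p ∣p∣≡1+k with nonempty? p
... | yes nonempty = nonempty
... | no  empty with () ← trans (sym (∣⊥∣≡0 n)) (trans (cong ∣_∣ (sym (Empty-unique empty))) ∣p∣≡1+k)

distinct⇒vertex : {X Y : Subset n} → X ≢ Y → Fin n
distinct⇒vertex {zero}  {[]} {[]} []≢[] = ⊥-elim ([]≢[] refl)
distinct⇒vertex {suc n} _               = zero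

module _ {Q : ℕ → Set} {l : ℕ} where

  stepwise-↓ : (∀ m → m < l → Q (suc m) → Q m) → ∀ {i j} → i ≤ j → j ≤ l → Q j → Q i
  stepwise-↓ step {j = zero}  z≤n _ qj = qj
  stepwise-↓ step {j = suc j} i≤j j<l qj with m≤n⇒m<n∨m≡n i≤j
  ... | inj₂ refl       = qj
  ... | inj₁ (s≤s i≤j′) = stepwise-↓ step i≤j′ (<⇒≤ j<l) (step j j<l qj)

  stepwise-↑ : (∀ m → m < l → Q m → Q (suc m)) → ∀ {i j} → i ≤ j → j ≤ l → Q i → Q j
  stepwise-↑ step {j = zero}  z≤n _ qi = qi
  stepwise-↑ step {j = suc j} i≤j j<l qi with m≤n⇒m<n∨m≡n i≤j
  ... | inj₂ refl       = qi
  ... | inj₁ (s≤s i≤j′) = step j j<l (stepwise-↑ step i≤j′ (<⇒≤ j<l) qi)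

module _ {V : Set} where

  last-∷ : ∀ (x y : V) ys → last (x ∷ y ∷ ys) ≡ last (y ∷ ys)
  last-∷ x y ys with initLast ys
  ... | []       = refl
  ... | _ ∷ʳ′ _ = refl

  last-∈ : ∀ (x : V) xs → last (x ∷ xs) ∈ₗ x ∷ xs
  last-∈ x []       = here refl
  last-∈ x (y ∷ ys) = there (subst (_∈ₗ y ∷ ys) (sym (last-∷ x y ys)) (last-∈ y ys))

module _ {V : Set} {R : V → V → Set} where

  visited : ∀ {u v} → Star R u v → List V
  visited ε                 = []
  visited (_◅_ {j = j} _ w) = j ∷ visited w

  visited-◅◅ : ∀ {u v w} (w₁ : Star R u v) (w₂ : Star R v w) →
               visited (w₁ ◅◅ w₂) ≡ visited w₁ ++ visited w₂
  visited-◅◅ ε        w₂ = refl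
  visited-◅◅ (e ◅ w₁) w₂ = cong (_ ∷_) (visited-◅◅ w₁ w₂)

  cutAtFirst : {P : V → Set} → Decidable P → ∀ {u v} (w : Star R u v) → P v →
               ∃₂ λ x (w′ : Star R u x) → P x
                 × All (λ z → z ≡ x ⊎ ¬ P z) (u ∷ visited w′)
                 × u ∷ visited w′ ⊆ₗ u ∷ visited w
  cutAtFirst P? {u} w Pv with P? u
  ... | yes Pu = u , ε , Pu , inj₁ refl ∷ [] , ∷⁺ʳ u (λ ())
  cutAtFirst P? ε       Pv | no ¬Pu = ⊥-elim (¬Pu Pv)
  cutAtFirst P? (e ◅ w) Pv | no ¬Pu with x , w′ , Px , firstHit , w′⊆w ← cutAtFirst P? w Pv =
    x , e ◅ w′ , Px , inj₂ ¬Pu ∷ firstHit , ∷⁺ʳ _ w′⊆w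

  record IsPath (u v : V) (rest : List V) : Set where
    field
      linked : Linked R (u ∷ rest)
      unique : Unique (u ∷ rest)
      ends   : last (u ∷ rest) ≡ v

  suffix-isPath : ∀ {x y v ys} → x ∈ₗ y ∷ ys → IsPath y v ys → ∃ λ zs → IsPath x v zs × x ∷ zs ⊆ₗ y ∷ ys
  suffix-isPath (here refl) path = _ , path , ⊆-refl
  suffix-isPath {y = y} {ys = y′ ∷ ys} (there x∈)
                record { linked = _ ∷ linked ; unique = _ ∷ unique ; ends = ends }
    with zs , path , zs⊆ ← suffix-isPath x∈ record { linked = linked ; unique = unique
                                                  ; ends = trans (sym (last-∷ y y′ ys)) ends }
    = zs , path , ⊆-trans zs⊆ (xs⊆x∷xs _ y)

  module _ (_≟ᵥ_ : DecidableEquality V) where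
    open DecMembership _≟ᵥ_ using () renaming (_∈?_ to _∈ₗ?_)

    eraseLoops : ∀ {u v} (w : Star R u v) → ∃ λ rest → IsPath u v rest × u ∷ rest ⊆ₗ u ∷ visited w
    eraseLoops ε = [] , record { linked = [-] ; unique = [] ∷ [] ; ends = refl } , ⊆-refl
    eraseLoops {u} (_◅_ {j = j} e w) with rest , path , rest⊆ ← eraseLoops w | u ∈ₗ? j ∷ rest
    ... | yes u∈ with zs , path′ , zs⊆ ← suffix-isPath u∈ path =
      zs , path′ , ⊆-trans zs⊆ (⊆-trans rest⊆ (xs⊆x∷xs _ u))
    ... | no u∉ = j ∷ rest , path′ , ∷⁺ʳ u rest⊆
      where
      path′ : IsPath u _ (j ∷ rest)
      path′ = record
        { linked = e ∷ IsPath.linked path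
        ; unique = ¬Any⇒All¬ _ u∉ ∷ IsPath.unique path
        ; ends   = trans (last-∷ u j rest) (IsPath.ends path)
        }

-- Tokens

transpose-matchˡ : ∀ (i j : Fin n) → PC.transpose i j i ≡ j
transpose-matchˡ i j with i ≟ i
... | yes _  = refl
... | no i≢i = ⊥-elim (i≢i refl)

transpose-matchʳ : ∀ (i j : Fin n) → PC.transpose i j j ≡ i
transpose-matchʳ i j with j ≟ i
... | yes j≡i = j≡i
... | no _ with j ≟ j
...   | yes _  = refl
...   | no j≢j = ⊥-elim (j≢j refl)

transpose-fix : ∀ {i j k : Fin n} → k ≢ i → k ≢ j → PC.transpose i j k ≡ k
transpose-fix {i = i} {j} {k} k≢i k≢j with k ≟ i
... | yes k≡i = ⊥-elim (k≢i k≡i)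
... | no _ with k ≟ j
...   | yes k≡j = ⊥-elim (k≢j k≡j)
...   | no _    = refl

module _ {H : Graph} where

  Transfers : Subset (N H) → Subset (N H) → Fin (N H) → Fin (N H) → Set
  Transfers X X′ s t = s ∈ X × s ∉ X′ × t ∉ X × t ∈ X′

  TokenMove : Subset (N H) → Subset (N H) → Path H → Set
  TokenMove X X′ P = Transfers X X′ (start P) (end P) ⊎ Transfers X X′ (end P) (start P)

  TokenMovement : Movement H → Set
  TokenMovement mv = ∀ m → m < len mv → TokenMove (sets mv m) (sets mv (suc m)) (moves mv (suc m))

  TokenMove⇒∉ends : ∀ {X X′ P x} → TokenMove X X′ P → x ∈ X → x ∈ X′ → x ≢ start P × x ≢ end P
  TokenMove⇒∉ends (inj₁ (_ , s∉ , t∉ , _)) x∈ x∈′ = (λ { refl → s∉ x∈′ }) , (λ { refl → t∉ x∈ })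
  TokenMove⇒∉ends (inj₂ (_ , t∉ , s∉ , _)) x∈ x∈′ = (λ { refl → s∉ x∈ }) , (λ { refl → t∉ x∈′ })

  -- origin mv i ⟨$⟩ʳ x is where the token sitting on x at time i started.
  origin : Movement H → ℕ → Permutation′ (N H)
  origin mv zero    = idₚ
  origin mv (suc m) = transpose (start P) (end P) ∘ₚ origin mv m
    where P = moves mv (suc m)

  track : Movement H → RVertex H → Fin (N H)
  track mv (i , x) = origin mv i ⟨$⟩ʳ x

  module _ {mv : Movement H} where

    private
      move : ℕ → Path H
      move m = moves mv (suc m)

    track-REdge : ∀ {m u v} → TokenMove (sets mv m) (sets mv (suc m)) (move m) →
                  REdge mv m u v → track mv u ≡ track mv v
    track-REdge {m} token (vertical x∈ x∈′) =
      let x≢s , x≢t = TokenMove⇒∉ends {P = move m} token x∈ x∈′ in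
      sym (cong (origin mv m ⟨$⟩ʳ_) (transpose-fix x≢s x≢t))
    track-REdge {m} (inj₁ _) (moveEdge (inj₁ (refl , _)) (inj₂ (refl , _))) =
      sym (cong (origin mv m ⟨$⟩ʳ_) (transpose-matchʳ (start (move m)) (end (move m))))
    track-REdge {m} (inj₂ _) (moveEdge (inj₂ (refl , _)) (inj₁ (refl , _))) =
      cong (origin mv m ⟨$⟩ʳ_) (transpose-matchˡ (start (move m)) (end (move m)))
    track-REdge (inj₁ (s∈ , _ , _ , _)) (moveEdge (inj₂ (_ , s∉)) _) = ⊥-elim (s∉ s∈)
    track-REdge (inj₁ (_ , _ , t∉ , _)) (moveEdge _ (inj₁ (_ , t∈))) = ⊥-elim (t∉ t∈)
    track-REdge (inj₂ (_ , _ , s∉ , _)) (moveEdge (inj₁ (_ , s∈)) _) = ⊥-elim (s∉ s∈)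
    track-REdge (inj₂ (t∈ , _ , _ , _)) (moveEdge _ (inj₂ (_ , t∉))) = ⊥-elim (t∉ t∈)

    track-RConnected : TokenMovement mv → ∀ {u v} → RConnected mv u v → track mv u ≡ track mv v
    track-RConnected token ε = refl
    track-RConnected token (fwd (m , m<n , e) ◅ path) =
      trans (track-REdge (token m m<n) e) (track-RConnected token path)
    track-RConnected token (bwd (m , m<n , e) ◅ path) =
      trans (sym (track-REdge (token m m<n) e)) (track-RConnected token path)

    TokenMovement⇒Balanced : TokenMovement mv → Balanced mv
    TokenMovement⇒Balanced token (i , x) (i′ , x′) (side , side′ , u≢v , path) =
      pairing side side′ (track-RConnected token path)
      where
      pairing : Boundary mv (i , x) → Boundary mv (i′ , x′) → track mv (i , x) ≡ track mv (i′ , x′) →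
                (Side0 mv (i , x) × SideInf mv (i′ , x′)) ⊎ (SideInf mv (i , x) × Side0 mv (i′ , x′))
      pairing (inj₁ s₀) (inj₂ s∞) _ = inj₁ (s₀ , s∞)
      pairing (inj₂ s∞) (inj₁ s₀) _ = inj₂ (s∞ , s₀)
      pairing (inj₁ (refl , _)) (inj₁ (refl , _)) same = ⊥-elim (u≢v (cong (0 ,_) same))
      pairing (inj₂ (refl , _)) (inj₂ (refl , _)) same =
        ⊥-elim (u≢v (cong (len mv ,_) (Injection.injective (↔⇒↣ (origin mv (len mv))) same)))

-- Movements inside a set of vertices, avoiding A

module Reconfiguration (H : Graph) (A : Subset (N H)) where

  private
    V : Set
    V = Fin (N H)
    open DecMembership (_≟_ {N H}) using () renaming (_∈?_ to _∈ₗ?_)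

  record Step (vs : List V) (X X′ : Subset (N H)) (P : Path H) : Set where
    field
      nontrivial : IsNontrivialPath H P
      within     : ∀ z → OnPath z P → z ∈ₗ vs
      avoids     : ∀ a → a ∈ A → ¬ Inner a P
      token      : TokenMove X X′ P
      elsewhere  : ∀ z → z ≢ start P → z ≢ end P → (z ∈ X → z ∈ X′) × (z ∈ X′ → z ∈ X)
      disjoint   : ∀ z → OnPath z P → ¬ (z ∈ X × z ∈ X′)

  Step-sym : ∀ {vs X X′ P} → Step vs X X′ P → Step vs X′ X P
  Step-sym step = record
    { nontrivial = Step.nontrivial step
    ; within     = Step.within step
    ; avoids     = Step.avoids step
    ; token      = Sum.swap (Sum.map swapTransfer swapTransfer (Step.token step))
    ; elsewhere  = λ z z≢s z≢t → Product.swap (Step.elsewhere step z z≢s z≢t)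
    ; disjoint   = λ z z∈P → Step.disjoint step z z∈P ∘ Product.swap
    }
    where
    swapTransfer : ∀ {X X′ s t} → Transfers {H} X X′ s t → Transfers {H} X′ X t s
    swapTransfer (s∈ , s∉′ , t∉ , t∈′) = t∈′ , t∉ , s∉′ , s∈

  module _ {vs X X′ P} (step : Step vs X X′ P) where
    open Step step

    Step⇒changed⇒end : ∀ z → (z ∈ X × z ∉ X′) ⊎ (z ∉ X × z ∈ X′) → z ≡ start P ⊎ z ≡ end P
    Step⇒changed⇒end z changed with z ≟ start P | z ≟ end P
    ... | yes z≡s | _       = inj₁ z≡s
    ... | no _    | yes z≡t = inj₂ z≡t
    ... | no z≢s  | no z≢t with elsewhere z z≢s z≢t | changed
    ...   | kept , _ | inj₁ (z∈ , z∉′) = ⊥-elim (z∉′ (kept z∈))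
    ...   | _ , kept | inj₂ (z∉ , z∈′) = ⊥-elim (z∉ (kept z∈′))

    Step⇒end⇒changed : ∀ z → z ≡ start P ⊎ z ≡ end P → (z ∈ X × z ∉ X′) ⊎ (z ∉ X × z ∈ X′)
    Step⇒end⇒changed z end with token
    Step⇒end⇒changed z (inj₁ refl) | inj₁ (s∈ , s∉′ , _ , _) = inj₁ (s∈ , s∉′)
    Step⇒end⇒changed z (inj₂ refl) | inj₁ (_ , _ , t∉ , t∈′) = inj₂ (t∉ , t∈′)
    Step⇒end⇒changed z (inj₁ refl) | inj₂ (_ , _ , s∉ , s∈′) = inj₂ (s∉ , s∈′)
    Step⇒end⇒changed z (inj₂ refl) | inj₂ (t∈ , t∉′ , _ , _) = inj₁ (t∈ , t∉′)

  NeverEnters NeverLeaves : Movement H → V → Set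
  NeverEnters mv a = ∀ m → m < len mv → a ∈ sets mv (suc m) → a ∈ sets mv m
  NeverLeaves mv a = ∀ m → m < len mv → a ∈ sets mv m → a ∈ sets mv (suc m)

  module _ (mv : Movement H) {a : V} where

    NeverLeaves⇒NeverEnters : NeverLeaves mv a → a ∉ sets mv (len mv) → NeverEnters mv a
    NeverLeaves⇒NeverEnters never a∉ₙ m m<n a∈ = ⊥-elim (a∉ₙ (stepwise-↑ never m<n ≤-refl a∈))

    NeverEnters⇒NeverLeaves : NeverEnters mv a → a ∈ sets mv (len mv) → NeverLeaves mv a
    NeverEnters⇒NeverLeaves never a∈ₙ m m<n _ = stepwise-↓ never m<n ≤-refl a∈ₙ

  record Admissible (vs : List V) (mv : Movement H) : Set where
    field
      steps    : ∀ m → m < len mv → Step vs (sets mv m) (sets mv (suc m)) (moves mv (suc m))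
      monotone : ∀ a → a ∈ A → NeverEnters mv a ⊎ NeverLeaves mv a

  module _ {vs mv} (admissible : Admissible vs mv) where
    open Admissible admissible

    Admissible⇒IsMovement : 1 ≤ len mv → IsMovement H mv
    Admissible⇒IsMovement nonempty = nonempty , λ m m<n → let step = steps m m<n in
      Step.nontrivial step , (λ z → Step⇒changed⇒end step z , Step⇒end⇒changed step z) , Step.disjoint step

    Admissible⇒TokenMovement : TokenMovement mv
    Admissible⇒TokenMovement m m<n = Step.token (steps m m<n)

    Admissible⇒StronglySingularSet : StronglySingularSet mv A
    Admissible⇒StronglySingularSet a a∈A =
      ((λ m m<n → Step.avoids (steps m m<n) a a∈A) , convex (monotone a a∈A)) , touchesEnd (monotone a a∈A)
      where
      convex : NeverEnters mv a ⊎ NeverLeaves mv a → ∀ i j k → i ≤ j → j ≤ k → k ≤ len mv →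
               a ∈ sets mv i → a ∈ sets mv k → a ∈ sets mv j
      convex (inj₁ never) i j k i≤j j≤k k≤n _  a∈ = stepwise-↓ never j≤k k≤n a∈
      convex (inj₂ never) i j k i≤j j≤k k≤n a∈ _  = stepwise-↑ never i≤j (≤-trans j≤k k≤n) a∈
      touchesEnd : NeverEnters mv a ⊎ NeverLeaves mv a →
                   (∀ i → i ≤ len mv → a ∉ sets mv i) ⊎ a ∈ sets mv 0 ⊎ a ∈ sets mv (len mv)
      touchesEnd monotonic with a ∈? sets mv 0 | a ∈? sets mv (len mv) | monotonic
      ... | yes a∈₀ | _       | _          = inj₂ (inj₁ a∈₀)
      ... | no _    | yes a∈ₙ | _          = inj₂ (inj₂ a∈ₙ)
      ... | no a∉₀  | no _    | inj₁ never = inj₁ λ i i≤n a∈ → a∉₀ (stepwise-↓ never z≤n i≤n a∈)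
      ... | no _    | no a∉ₙ  | inj₂ never = inj₁ λ i i≤n a∈ → a∉ₙ (stepwise-↑ never i≤n ≤-refl a∈)

  -- v only fills the move slots, which a movement of length 0 never consults.
  stay : V → Subset (N H) → Movement H
  stay v X = record { len = 0 ; sets = λ _ → X ; moves = λ _ → mkPath v [] }

  stay-admissible : ∀ {vs} v X → Admissible vs (stay v X)
  stay-admissible v X = record { steps = λ _ () ; monotone = λ _ _ → inj₁ λ _ () }

  weaken : ∀ {vs vs′ mv} → vs ⊆ₗ vs′ → Admissible vs mv → Admissible vs′ mv
  weaken vs⊆vs′ admissible = record
    { steps    = λ m m<n → widen (Admissible.steps admissible m m<n)
    ; monotone = Admissible.monotone admissible
    }
    where
    widen : ∀ {X X′ P} → Step _ X X′ P → Step _ X X′ P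
    widen step = record
      { nontrivial = Step.nontrivial step
      ; within     = λ z z∈P → vs⊆vs′ (Step.within step z z∈P)
      ; avoids     = Step.avoids step
      ; token      = Step.token step
      ; elsewhere  = Step.elsewhere step
      ; disjoint   = Step.disjoint step
      }

  lift : Subset (N H) → Movement H → Movement H
  lift B mv = record mv { sets = λ i → sets mv i ∪ B }

  module _ {B : Subset (N H)} where

    private
      ∈∪⁺ : ∀ {z X} → z ∈ X → z ∈ X ∪ B
      ∈∪⁺ = p⊆p∪q B

      ∈∪⁻ : ∀ {z X} → z ∉ B → z ∈ X ∪ B → z ∈ X
      ∈∪⁻ {X = X} z∉B z∈ = [ id , (λ z∈B → ⊥-elim (z∉B z∈B)) ] (x∈p∪q⁻ X B z∈)

      B⊆∪ : ∀ {z X} → z ∈ B → z ∈ X ∪ B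
      B⊆∪ {X = X} = q⊆p∪q X B

    lift-step : ∀ {vs X X′ P} → (∀ z → z ∈ₗ vs → z ∉ B) → Step vs X X′ P → Step vs (X ∪ B) (X′ ∪ B) P
    lift-step {vs} {X} {X′} {P} vs∩B≡∅ step = record
      { nontrivial = Step.nontrivial step
      ; within     = Step.within step
      ; avoids     = Step.avoids step
      ; token      = liftToken (Step.token step)
      ; elsewhere  = elsewhere
      ; disjoint   = λ z z∈P (z∈ , z∈′) →
                       Step.disjoint step z z∈P (∈∪⁻ (offB z z∈P) z∈ , ∈∪⁻ (offB z z∈P) z∈′)
      }
      where
      offB : ∀ z → OnPath z P → z ∉ B
      offB z z∈P = vs∩B≡∅ z (Step.within step z z∈P)
      s∉B = offB (start P) (here refl)
      t∉B = offB (end P) (last-∈ (start P) (rest P))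
      liftToken : TokenMove X X′ P → TokenMove (X ∪ B) (X′ ∪ B) P
      liftToken (inj₁ (s∈ , s∉′ , t∉ , t∈′)) = inj₁ (∈∪⁺ s∈ , s∉′ ∘ ∈∪⁻ s∉B , t∉ ∘ ∈∪⁻ t∉B , ∈∪⁺ t∈′)
      liftToken (inj₂ (t∈ , t∉′ , s∉ , s∈′)) = inj₂ (∈∪⁺ t∈ , t∉′ ∘ ∈∪⁻ t∉B , s∉ ∘ ∈∪⁻ s∉B , ∈∪⁺ s∈′)
      elsewhere : ∀ z → z ≢ start P → z ≢ end P → (z ∈ X ∪ B → z ∈ X′ ∪ B) × (z ∈ X′ ∪ B → z ∈ X ∪ B)
      elsewhere z z≢s z≢t with z ∈? B
      ... | yes z∈B = (λ _ → B⊆∪ z∈B) , (λ _ → B⊆∪ z∈B)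
      ... | no z∉B  = let kept , kept′ = Step.elsewhere step z z≢s z≢t in
                      (∈∪⁺ ∘ kept ∘ ∈∪⁻ z∉B) , (∈∪⁺ ∘ kept′ ∘ ∈∪⁻ z∉B)

    lift-admissible : ∀ {vs mv} → (∀ z → z ∈ₗ vs → z ∉ B) → Admissible vs mv → Admissible vs (lift B mv)
    lift-admissible {mv = mv} vs∩B≡∅ admissible = record
      { steps    = λ m m<n → lift-step vs∩B≡∅ (Admissible.steps admissible m m<n)
      ; monotone = monotone
      }
      where
      monotone : ∀ a → a ∈ A → NeverEnters (lift B mv) a ⊎ NeverLeaves (lift B mv) a
      monotone a a∈A with a ∈? B | Admissible.monotone admissible a a∈A
      ... | yes a∈B | _          = inj₂ λ _ _ _ → B⊆∪ a∈B
      ... | no a∉B  | inj₁ never = inj₁ λ m m<n → ∈∪⁺ ∘ never m m<n ∘ ∈∪⁻ a∉B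
      ... | no a∉B  | inj₂ never = inj₂ λ m m<n → ∈∪⁺ ∘ never m m<n ∘ ∈∪⁻ a∉B

  cons : Path H → Subset (N H) → Movement H → Movement H
  cons P X mv = record { len = suc (len mv) ; sets = sets′ ; moves = moves′ }
    where
    sets′ : ℕ → Subset (N H)
    sets′ zero    = X
    sets′ (suc i) = sets mv i
    moves′ : ℕ → Path H
    moves′ (suc (suc i)) = moves mv (suc i)
    moves′ _             = P

  cons-admissible : ∀ {vs P X mv} → Step vs X (sets mv 0) P → Admissible vs mv →
    (∀ a → a ∈ A → a ∈ X → a ∉ sets mv 0 → a ∉ sets mv (len mv)) →
    (∀ a → a ∈ A → a ∉ X → a ∈ sets mv 0 → a ∈ sets mv (len mv)) →
    Admissible vs (cons P X mv)
  cons-admissible {vs} {P} {X} {mv} first admissible leavesForGood entersForGood = record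
    { steps    = steps
    ; monotone = monotone
    }
    where
    mv′ = cons P X mv

    steps : ∀ m → m < len mv′ → Step vs (sets mv′ m) (sets mv′ (suc m)) (moves mv′ (suc m))
    steps zero    _         = first
    steps (suc m) (s≤s m<n) = Admissible.steps admissible m m<n

    module _ {a : V} where
      entersᶜ : (a ∈ sets mv 0 → a ∈ X) → NeverEnters mv a → NeverEnters mv′ a
      entersᶜ first never zero    _         = first
      entersᶜ first never (suc m) (s≤s m<n) = never m m<n

      leavesᶜ : (a ∈ X → a ∈ sets mv 0) → NeverLeaves mv a → NeverLeaves mv′ a
      leavesᶜ first never zero    _         = first
      leavesᶜ first never (suc m) (s≤s m<n) = never m m<n

    monotone : ∀ a → a ∈ A → NeverEnters mv′ a ⊎ NeverLeaves mv′ a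
    monotone a a∈A with a ∈? X | a ∈? sets mv 0 | Admissible.monotone admissible a a∈A
    ... | yes a∈X | yes a∈₀ | monotonic = Sum.map (entersᶜ λ _ → a∈X) (leavesᶜ λ _ → a∈₀) monotonic
    ... | no a∉X  | no a∉₀  | monotonic = Sum.map (entersᶜ (⊥-elim ∘ a∉₀)) (leavesᶜ (⊥-elim ∘ a∉X)) monotonic
    ... | yes a∈X | no a∉₀  | monotonic = inj₁ (entersᶜ (⊥-elim ∘ a∉₀)
      ([ id , (λ never → NeverLeaves⇒NeverEnters mv never (leavesForGood a a∈A a∈X a∉₀)) ] monotonic))
    ... | no a∉X  | yes a∈₀ | monotonic = inj₂ (leavesᶜ (⊥-elim ∘ a∉X)
      ([ (λ never → NeverEnters⇒NeverLeaves mv never (entersForGood a a∈A a∉X a∈₀)) , id ] monotonic))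

  reverse : Movement H → Movement H
  reverse mv = record { len = len mv ; sets = λ i → sets mv (len mv ∸ i) ; moves = moves′ }
    where
    moves′ : ℕ → Path H
    moves′ zero    = moves mv zero
    moves′ (suc m) = moves mv (len mv ∸ m)

  reverse-admissible : ∀ {vs mv} → Admissible vs mv → Admissible vs (reverse mv)
  reverse-admissible {vs} {mv} admissible = record { steps = steps ; monotone = monotone }
    where
    l = len mv

    mirror : ∀ {m} → m < l → l ∸ suc m < l × suc (l ∸ suc m) ≡ l ∸ m
    mirror {m} m<l = subst (_≤ l) shift (m∸n≤m l m) , sym shift
      where
      shift : l ∸ m ≡ suc (l ∸ suc m)
      shift = +-∸-assoc 1 m<l

    steps : ∀ m → m < l → Step vs (sets mv (l ∸ m)) (sets mv (l ∸ suc m)) (moves mv (l ∸ m))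
    steps m m<l = let k<l , eq = mirror m<l in
      Step-sym (subst (λ j → Step vs (sets mv (l ∸ suc m)) (sets mv j) (moves mv j)) eq
                      (Admissible.steps admissible (l ∸ suc m) k<l))

    monotone : ∀ a → a ∈ A → NeverEnters (reverse mv) a ⊎ NeverLeaves (reverse mv) a
    monotone a a∈A with Admissible.monotone admissible a a∈A
    ... | inj₁ never = inj₂ λ m m<l → let k<l , eq = mirror m<l in
                         never (l ∸ suc m) k<l ∘ subst (λ i → a ∈ sets mv i) (sym eq)
    ... | inj₂ never = inj₁ λ m m<l → let k<l , eq = mirror m<l in
                         subst (λ i → a ∈ sets mv i) eq ∘ never (l ∸ suc m) k<l

  -- Trees grown leaf by leaf, the newest vertex first

  data Tree : List V → Set where
    root : ∀ r → Tree (r ∷ [])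
    leaf : ∀ {vs v p} → Tree vs → ¬ v ∈ₗ vs → p ∈ₗ vs → p ∉ A → Adj H v p → Tree (v ∷ vs)

  Tree-fresh : ∀ {ℓ vs} → Tree (ℓ ∷ vs) → ¬ ℓ ∈ₗ vs
  Tree-fresh (root _)           ()
  Tree-fresh (leaf _ ℓ∉vs _ _ _) = ℓ∉vs

  Tree-fresh-⁅⁆ : ∀ {ℓ vs} → Tree (ℓ ∷ vs) → ∀ z → z ∈ₗ vs → z ∉ ⁅ ℓ ⁆
  Tree-fresh-⁅⁆ {ℓ} {vs} t z z∈vs z∈⁅ℓ⁆ = Tree-fresh t (subst (_∈ₗ vs) (x∈⁅y⁆⇒x≡y ℓ z∈⁅ℓ⁆) z∈vs)

  Confined : List V → V → List V → Set
  Confined vs w = All (λ z → z ∈ₗ vs × (z ≡ w ⊎ z ∉ A))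

  treeWalk : ∀ {vs u w} → Tree vs → u ∈ₗ vs → w ∈ₗ vs → Σ (Star (Adj H) u w) (Confined vs w ∘ visited)
  treeWalk (root r)         (here refl) (here refl) = ε , []
  treeWalk (leaf _ _ _ _ _) (here refl) (here refl) = ε , []
  treeWalk (leaf t _ p∈ p∉A v~p) (here refl) (there w∈) =
    let walk , confined = treeWalk t p∈ w∈ in
    v~p ◅ walk , (there p∈ , inj₂ p∉A) ∷ All.map (Product.map₁ there) confined
  treeWalk (leaf t _ p∈ p∉A v~p) (there u∈) (here refl) =
    let walk , confined = treeWalk t u∈ p∈ in
    walk ◅◅ (Graph.sym H v~p ◅ ε) ,
    subst (Confined _ _) (sym (visited-◅◅ walk _))
      (++⁺ (All.map (Product.map there [ (λ { refl → inj₂ p∉A }) , inj₂ ]) confined)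
           ((here refl , inj₁ refl) ∷ []))
  treeWalk (leaf t _ _ _ _) (there u∈) (there w∈) =
    let walk , confined = treeWalk t u∈ w∈ in walk , All.map (Product.map₁ there) confined

  record LeadsInto (vs : List V) (X : Subset (N H)) (P : Path H) : Set where
    field
      nontrivial : IsNontrivialPath H P
      within     : ∀ z → OnPath z P → z ∈ₗ vs
      avoids     : ∀ a → a ∈ A → ¬ Inner a P
      hits       : end P ∈ X
      firstHit   : ∀ z → OnPath z P → z ≡ end P ⊎ z ∉ X

  pathInto : ∀ {vs u x₀} {X : Subset (N H)} → Tree vs → u ∈ₗ vs → u ∉ X → x₀ ∈ₗ vs → x₀ ∈ X →
             ∃ λ rest → LeadsInto vs X (mkPath u rest)
  pathInto {vs} {u} {x₀} {X} t u∈ u∉X x₀∈ x₀∈X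
    with walk , confined ← treeWalk t u∈ x₀∈
    with x , walk′ , x∈X , firstHit , walk′⊆walk ← cutAtFirst (_∈? X) walk x₀∈X
    with rest , path , rest⊆walk′ ← eraseLoops _≟_ walk′
    = rest , record
      { nontrivial = nonempty , IsPath.linked path , IsPath.unique path
      ; within     = within
      ; avoids     = avoids
      ; hits       = subst (_∈ X) (sym ends) x∈X
      ; firstHit   = λ z z∈P → Sum.map₁ (λ z≡x → trans z≡x (sym ends)) (All.lookup firstHit (rest⊆walk′ z∈P))
      }
    where
    ends = IsPath.ends path
    P = mkPath {H} u rest
    onWalk : ∀ {z} → OnPath z P → z ∈ₗ u ∷ visited walk
    onWalk = walk′⊆walk ∘ rest⊆walk′
    nonempty : rest ≢ []
    nonempty refl = u∉X (subst (_∈ X) (sym ends) x∈X)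
    within : ∀ z → OnPath z P → z ∈ₗ vs
    within z z∈P with onWalk z∈P
    ... | here refl = u∈
    ... | there z∈  = proj₁ (All.lookup confined z∈)
    avoids : ∀ a → a ∈ A → ¬ Inner a P
    avoids a a∈A (a∈P , a≢u , a≢end) with onWalk a∈P
    ... | here a≡u = a≢u a≡u
    ... | there a∈ with proj₂ (All.lookup confined a∈)
    ...   | inj₂ a∉A  = a∉A a∈A
    ...   | inj₁ refl with All.lookup firstHit (rest⊆walk′ a∈P)
    ...     | inj₁ refl = a≢end (sym ends)
    ...     | inj₂ a∉X  = a∉X x₀∈X

  transferStep : ∀ {vs ℓ rest X} → let P = mkPath ℓ rest in
                 LeadsInto vs X P → ℓ ∉ X → Step vs X ((X - end P) ∪ ⁅ ℓ ⁆) P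
  transferStep {vs} {ℓ} {rest} {X} leads ℓ∉X = record
    { nontrivial = LeadsInto.nontrivial leads
    ; within     = LeadsInto.within leads
    ; avoids     = LeadsInto.avoids leads
    ; token      = inj₂ (hit∈X , hit∉X₁ , ℓ∉X , q⊆p∪q (X - hit) ⁅ ℓ ⁆ (x∈⁅x⁆ ℓ))
    ; elsewhere  = λ z z≢ℓ z≢hit → (p⊆p∪q ⁅ ℓ ⁆ ∘ λ z∈X → x∈p∧x≢y⇒x∈p-y z∈X z≢hit)
                                 , (p─q⊆p X ⁅ hit ⁆ ∘ ∈X-hit z≢ℓ)
    ; disjoint   = disjoint
    }
    where
    P = mkPath {H} ℓ rest
    hit = end P
    hit∈X = LeadsInto.hits leads
    X₁ = (X - hit) ∪ ⁅ ℓ ⁆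
    ∈X-hit : ∀ {z} → z ≢ ℓ → z ∈ X₁ → z ∈ X - hit
    ∈X-hit z≢ℓ z∈ = [ id , (λ z∈⁅ℓ⁆ → ⊥-elim (z≢ℓ (x∈⁅y⁆⇒x≡y ℓ z∈⁅ℓ⁆))) ] (x∈p∪q⁻ (X - hit) ⁅ ℓ ⁆ z∈)
    hit∉X₁ : hit ∉ X₁
    hit∉X₁ = x∉p-x X hit ∘ ∈X-hit (λ hit≡ℓ → ℓ∉X (subst (_∈ X) hit≡ℓ hit∈X))
    disjoint : ∀ z → OnPath z P → ¬ (z ∈ X × z ∈ X₁)
    disjoint z z∈P (z∈X , z∈X₁) with LeadsInto.firstHit leads z z∈P
    ... | inj₁ refl = hit∉X₁ z∈X₁
    ... | inj₂ z∉X  = z∉X z∈X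

  Within : List V → Subset (N H) → Set
  Within vs X = ∀ {z} → z ∈ X → z ∈ₗ vs

  record Problem (vs : List V) (X Y : Subset (N H)) : Set where
    field
      withinˣ  : Within vs X
      withinʸ  : Within vs Y
      sameSize : ∣ X ∣ ≡ ∣ Y ∣
      noShared : ∀ a → a ∈ A → a ∈ X → a ∉ Y

  record MovementBetween (vs : List V) (X Y : Subset (N H)) : Set where
    field
      movement   : Movement H
      starts     : sets movement 0 ≡ X
      ends       : sets movement (len movement) ≡ Y
      admissible : Admissible vs movement
      short      : len movement ≤ ∣ X ∣

  Reconfigurable : List V → Set
  Reconfigurable vs = ∀ {X Y} → Problem vs X Y → MovementBetween vs X Y

  Problem-shrink : ∀ {ℓ vs X Y} → Problem (ℓ ∷ vs) X Y → ℓ ∉ X → ℓ ∉ Y → Problem vs X Y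
  Problem-shrink problem ℓ∉X ℓ∉Y = record
    { withinˣ  = shrink withinˣ ℓ∉X
    ; withinʸ  = shrink withinʸ ℓ∉Y
    ; sameSize = sameSize
    ; noShared = noShared
    }
    where
    open Problem problem
    shrink : ∀ {ℓ vs Z} → Within (ℓ ∷ vs) Z → ℓ ∉ Z → Within vs Z
    shrink Z⊆ ℓ∉Z z∈Z with Z⊆ z∈Z
    ... | here refl = ⊥-elim (ℓ∉Z z∈Z)
    ... | there z∈  = z∈

  Problem-remove : ∀ {ℓ vs X Y x y} → Problem (ℓ ∷ vs) X Y → x ∈ X → y ∈ Y → ℓ ∉ X - x → ℓ ∉ Y - y →
                   Problem vs (X - x) (Y - y)
  Problem-remove {X = X} {Y} {x} {y} problem x∈X y∈Y = Problem-shrink record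
    { withinˣ  = withinˣ ∘ p─q⊆p X ⁅ x ⁆
    ; withinʸ  = withinʸ ∘ p─q⊆p Y ⁅ y ⁆
    ; sameSize = suc-injective (trans (x∈p⇒suc∣p-x∣≡∣p∣ x∈X) (trans sameSize (sym (x∈p⇒suc∣p-x∣≡∣p∣ y∈Y))))
    ; noShared = λ a a∈A a∈X a∈Y → noShared a a∈A (p─q⊆p X ⁅ x ⁆ a∈X) (p─q⊆p Y ⁅ y ⁆ a∈Y)
    }
    where open Problem problem

  module _ {vs : List V} {X Y : Subset (N H)} where

    Problem-sym : Problem vs X Y → Problem vs Y X
    Problem-sym problem = record
      { withinˣ  = withinʸ
      ; withinʸ  = withinˣ
      ; sameSize = sym sameSize
      ; noShared = λ a a∈A a∈Y a∈X → noShared a a∈A a∈X a∈Y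
      }
      where open Problem problem

    MovementBetween-weaken : ∀ {vs′} → vs ⊆ₗ vs′ → MovementBetween vs X Y → MovementBetween vs′ X Y
    MovementBetween-weaken vs⊆vs′ between = record
      { movement   = movement
      ; starts     = starts
      ; ends       = ends
      ; admissible = weaken vs⊆vs′ admissible
      ; short      = short
      }
      where open MovementBetween between

    MovementBetween-reverse : ∣ X ∣ ≡ ∣ Y ∣ → MovementBetween vs Y X → MovementBetween vs X Y
    MovementBetween-reverse |X|≡|Y| between = record
      { movement   = reverse movement
      ; starts     = ends
      ; ends       = trans (cong (sets movement) (n∸n≡0 (len movement))) starts
      ; admissible = reverse-admissible admissible
      ; short      = subst (len movement ≤_) (sym |X|≡|Y|) short
      }
      where open MovementBetween between

    MovementBetween-lift : ∀ {B} → B ⊆ₛ X → B ⊆ₛ Y → (∀ z → z ∈ₗ vs → z ∉ B) →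
                           MovementBetween vs (X ─ B) (Y ─ B) → MovementBetween vs X Y
    MovementBetween-lift {B} B⊆X B⊆Y vs∩B≡∅ between = record
      { movement   = lift B movement
      ; starts     = trans (cong (_∪ B) starts) (p─q∪q≡p B⊆X)
      ; ends       = trans (cong (_∪ B) ends) (p─q∪q≡p B⊆Y)
      ; admissible = lift-admissible vs∩B≡∅ admissible
      ; short      = ≤-trans short (∣p─q∣≤∣p∣ X B)
      }
      where open MovementBetween between

  reconfigure-[] : V → Reconfigurable []
  reconfigure-[] v {X} {Y} problem = record
    { movement   = stay v X
    ; starts     = refl
    ; ends       = trans (empty (Problem.withinˣ problem)) (sym (empty (Problem.withinʸ problem)))
    ; admissible = stay-admissible v X
    ; short      = z≤n
    }
    where
    empty : ∀ {Z} → Within [] Z → Z ≡ ⊥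
    empty Z⊆[] = Empty-unique λ (_ , z∈Z) → ¬Any[] (Z⊆[] z∈Z)

  module _ {ℓ vs} (t : Tree (ℓ ∷ vs)) (reconfigureVs : Reconfigurable vs) where

    tokenStays : ∀ {X Y} → Problem (ℓ ∷ vs) X Y → ℓ ∈ X → ℓ ∈ Y → MovementBetween (ℓ ∷ vs) X Y
    tokenStays {X} {Y} problem ℓ∈X ℓ∈Y =
      MovementBetween-weaken (xs⊆x∷xs vs ℓ)
        (MovementBetween-lift (x∈p⇒⁅x⁆⊆p ℓ∈X) (x∈p⇒⁅x⁆⊆p ℓ∈Y) (Tree-fresh-⁅⁆ t)
          (reconfigureVs (Problem-remove problem ℓ∈X ℓ∈Y (x∉p-x X ℓ) (x∉p-x Y ℓ))))

    tokenEnters : ∀ {X Y} → Problem (ℓ ∷ vs) X Y → ℓ ∉ X → ℓ ∈ Y → MovementBetween (ℓ ∷ vs) X Y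
    tokenEnters {X} {Y} problem ℓ∉X ℓ∈Y
      with x₀ , x₀∈X ← ∣p∣≡suc⇒Nonempty X (trans (Problem.sameSize problem) (sym (x∈p⇒suc∣p-x∣≡∣p∣ ℓ∈Y)))
      with rest , leads ← pathInto t (here refl) ℓ∉X (Problem.withinˣ problem x₀∈X) x₀∈X
      = enterAlong leads
      where
      open Problem problem
      enterAlong : ∀ {rest} → LeadsInto (ℓ ∷ vs) X (mkPath ℓ rest) → MovementBetween (ℓ ∷ vs) X Y
      enterAlong {rest} leads = record
        { movement   = cons P X mv
        ; starts     = refl
        ; ends       = final
        ; admissible = cons-admissible first
                         (weaken (xs⊆x∷xs vs ℓ) (lift-admissible (Tree-fresh-⁅⁆ t) admissible))
                         (λ a a∈A a∈X _ → subst (a ∉_) (sym final) (noShared a a∈A a∈X)) enters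
        ; short      = subst (suc (len movement) ≤_) (x∈p⇒suc∣p-x∣≡∣p∣ hit∈X) (s≤s short)
        }
        where
        P = mkPath ℓ rest
        hit = end P
        hit∈X = LeadsInto.hits leads
        open MovementBetween
          (reconfigureVs (Problem-remove problem hit∈X ℓ∈Y (ℓ∉X ∘ p─q⊆p X ⁅ hit ⁆) (x∉p-x Y ℓ)))
        mv = lift ⁅ ℓ ⁆ movement
        final : sets mv (len mv) ≡ Y
        final = trans (cong (_∪ ⁅ ℓ ⁆) ends) (x∈p⇒p-x∪⁅x⁆≡p ℓ∈Y)
        first : Step (ℓ ∷ vs) X (sets mv 0) P
        first = subst (λ Z → Step (ℓ ∷ vs) X (Z ∪ ⁅ ℓ ⁆) P) (sym starts) (transferStep leads ℓ∉X)
        enters : ∀ a → a ∈ A → a ∉ X → a ∈ sets mv 0 → a ∈ sets mv (len mv)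
        enters a a∈A a∉X a∈ with x∈p∪q⁻ (sets movement 0) ⁅ ℓ ⁆ a∈
        ... | inj₁ a∈₀   = ⊥-elim (a∉X (p─q⊆p X ⁅ hit ⁆ (subst (a ∈_) starts a∈₀)))
        ... | inj₂ a∈⁅ℓ⁆ = subst (a ∈_) (sym final) (subst (_∈ Y) (sym (x∈⁅y⁆⇒x≡y ℓ a∈⁅ℓ⁆)) ℓ∈Y)

    reconfigure-∷ : Reconfigurable (ℓ ∷ vs)
    reconfigure-∷ {X} {Y} problem with ℓ ∈? X | ℓ ∈? Y
    ... | no ℓ∉X  | no ℓ∉Y  =
      MovementBetween-weaken (xs⊆x∷xs vs ℓ) (reconfigureVs (Problem-shrink problem ℓ∉X ℓ∉Y))
    ... | yes ℓ∈X | yes ℓ∈Y = tokenStays problem ℓ∈X ℓ∈Y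
    ... | no ℓ∉X  | yes ℓ∈Y = tokenEnters problem ℓ∉X ℓ∈Y
    ... | yes ℓ∈X | no ℓ∉Y  =
      MovementBetween-reverse (Problem.sameSize problem)
        (tokenEnters (Problem-sym problem) ℓ∉Y ℓ∈X)

  reconfigure : ∀ {vs} → Tree vs → Reconfigurable vs
  reconfigure (root r)            = reconfigure-∷ (root r) (reconfigure-[] r)
  reconfigure t@(leaf t′ _ _ _ _) = reconfigure-∷ t (reconfigure t′)

  -- Spanning trees

  module _ (marginal : Marginal H A) {r : V} (r∉A : r ∉ A) where

    module _ {B : Subset (N H)} (B⊆A : B ⊆ₛ A) where

      private
        record Grown (vs : List V) : Set where
          field
            tree    : Tree vs
            hasRoot : r ∈ₗ vs
            avoidsB : ∀ z → z ∈ₗ vs → z ∉ B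

        Grows : List V → V → Set
        Grows vs u = ∃ λ vs′ → Grown vs′ × vs ⊆ₗ vs′ × (u ∉ B → u ∈ₗ vs′)

        attach : ∀ {vs v p} → Grown vs → ¬ v ∈ₗ vs → p ∈ₗ vs → p ∉ A → Adj H v p → v ∉ B → Grown (v ∷ vs)
        attach grown v∉vs p∈ p∉A v~p v∉B = record
          { tree    = leaf (Grown.tree grown) v∉vs p∈ p∉A v~p
          ; hasRoot = there (Grown.hasRoot grown)
          ; avoidsB = λ { z (here refl) → v∉B ; z (there z∈) → Grown.avoidsB grown z z∈ }
          }

        graft : ∀ {vs w u} → Grown vs → w ∈ₗ vs → Star (AdjMinus H A) w u → Grows vs u
        graft grown w∈ ε = _ , grown , ⊆-refl , λ _ → w∈
        graft {vs} grown w∈ (_◅_ {j = j} (w∉A , j∉A , w~j) walk) with j ∈ₗ? vs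
        ... | yes j∈ = graft grown j∈ walk
        ... | no  j∉
          with vs′ , grown′ , vs⊆vs′ , u∈
                 ← graft (attach grown j∉ w∈ w∉A (Graph.sym H w~j) (j∉A ∘ B⊆A)) (here refl) walk
          = vs′ , grown′ , vs⊆vs′ ∘ there , u∈

        graftFromRoot : ∀ {vs u} → Grown vs → u ∉ A → Grows vs u
        graftFromRoot grown u∉A = graft grown (Grown.hasRoot grown) (proj₁ marginal r _ r∉A u∉A)

        ensure : ∀ {vs} → Grown vs → ∀ u → Grows vs u
        ensure grown u with u ∈? A | u ∈? B
        ... | no u∉A  | _       = graftFromRoot grown u∉A
        ... | yes _   | yes u∈B = _ , grown , ⊆-refl , λ u∉B → ⊥-elim (u∉B u∈B)
        ... | yes u∈A | no u∉B
          with p , p∉A , u~p ← proj₂ marginal u u∈A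
          with vs′ , grown′ , vs⊆vs′ , p∈ ← graftFromRoot grown p∉A
          with u ∈ₗ? vs′
        ...   | yes u∈ = vs′ , grown′ , vs⊆vs′ , λ _ → u∈
        ...   | no  u∉ =
          u ∷ vs′ , attach grown′ u∉ (p∈ (p∉A ∘ B⊆A)) p∉A u~p u∉B , there ∘ vs⊆vs′ , λ _ → here refl

        cover : ∀ us → ∃ λ vs → Grown vs × (∀ u → u ∈ₗ us → u ∉ B → u ∈ₗ vs)
        cover [] = r ∷ [] , seed , λ _ ()
          where
          seed : Grown (r ∷ [])
          seed = record { tree = root r ; hasRoot = here refl ; avoidsB = λ { _ (here refl) → r∉A ∘ B⊆A } }
        cover (u ∷ us)
          with vs , grown , covered ← cover us
          with vs′ , grown′ , vs⊆vs′ , u∈ ← ensure grown u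
          = vs′ , grown′ , λ { _ (here refl) → u∈ ; z (there z∈) z∉B → vs⊆vs′ (covered z z∈ z∉B) }

      spanningTree : ∃ λ vs → Tree vs × (∀ z → z ∈ₗ vs → z ∉ B) × (∀ z → z ∉ B → z ∈ₗ vs)
      spanningTree with vs , grown , covered ← cover (allFin (N H)) =
        vs , Grown.tree grown , Grown.avoidsB grown , λ z → covered z (∈-allFin z)

    reconfigureAll : ∀ X Y → ∣ X ∣ ≡ ∣ Y ∣ → ∃ λ vs → MovementBetween vs X Y
    reconfigureAll X Y |X|≡|Y| with vs , tree , avoidsB , covers ← spanningTree (p∩q⊆p A (X ∩ Y)) =
      vs , MovementBetween-lift B⊆X B⊆Y avoidsB (reconfigure tree problem)
      where
      B = A ∩ (X ∩ Y)
      B⊆X : B ⊆ₛ X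
      B⊆X = p∩q⊆p X Y ∘ p∩q⊆q A (X ∩ Y)
      B⊆Y : B ⊆ₛ Y
      B⊆Y = p∩q⊆q X Y ∘ p∩q⊆q A (X ∩ Y)
      problem : Problem vs (X ─ B) (Y ─ B)
      problem = record
        { withinˣ  = λ z∈ → covers _ (x∈p─q⇒x∉q X B z∈)
        ; withinʸ  = λ z∈ → covers _ (x∈p─q⇒x∉q Y B z∈)
        ; sameSize = +-cancelʳ-≡ ∣ B ∣ _ _
            (trans (∣p─q∣+∣q∣≡∣p∣ X B B⊆X) (trans |X|≡|Y| (sym (∣p─q∣+∣q∣≡∣p∣ Y B B⊆Y))))
        ; noShared = λ a a∈A a∈X a∈Y →
            x∈p─q⇒x∉q X B a∈X (x∈p∩q⁺ (a∈A , x∈p∩q⁺ (p─q⊆p X B a∈X , p─q⊆p Y B a∈Y)))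
        }

vertexOutside : ∀ {H A} → Marginal H A → Fin (N H) → ∃ λ r → r ∉ A
vertexOutside {A = A} marginal v with v ∈? A
... | yes v∈A = let u , u∉A , _ = proj₂ marginal v v∈A in u , u∉A
... | no  v∉A = v , v∉A

lemma14 : (H : Graph) → Connected H →
    (X Y : Subset (N H)) → X ≢ Y → ∣ X ∣ ≡ ∣ Y ∣ →
    (A : Subset (N H)) → Marginal H A →
    Σ (Movement H) λ mv →
      IsMovement H mv × sets mv 0 ≡ X × sets mv (len mv) ≡ Y
      × Balanced mv × len mv ≤ ∣ X ∣ × StronglySingularSet mv A
lemma14 H _ X Y X≢Y |X|≡|Y| A marginal =
  movement , Admissible⇒IsMovement admissible (n≢0⇒n>0 len≢0) , starts , ends ,
  TokenMovement⇒Balanced (Admissible⇒TokenMovement admissible) , short ,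
  Admissible⇒StronglySingularSet admissible
  where
  open Reconfiguration H A
  anchor = vertexOutside {H} marginal (distinct⇒vertex X≢Y)
  open MovementBetween (proj₂ (reconfigureAll marginal (proj₂ anchor) X Y |X|≡|Y|))
  len≢0 : len movement ≢ 0
  len≢0 len≡0 = X≢Y (trans (sym starts) (trans (cong (sets movement) (sym len≡0)) ends))
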